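{- For every integer $n\ge 3$, the automorphism group of $G_n$ has exactly two orbits on the vertex set of $G_n$, each of size $5n$.
   Context: Let $P$ be the Petersen graph on vertex set $\{0,1,\dots,9\}$ whose 15 edges are the unordered pairs underlying the following set of directed edges (an orientation $\vec P$ of $P$): $E(\vec P)=\{(0,1),(0,4),(0,5),(1,2),(1,6),(2,3),(2,7),(3,4),(3,8),(4,9),(5,7),(5,8),(6,8),(6,9),(7,9)\}$. For $n\ge 3$ let $\sigma$ be the cyclic permutation of $\{1,\dots,n\}$ given by $\sigma(i)=i+1$ for $i<n$ and $\sigma(n)=1$. The graph $G_n$ is the simple undirected graph with vertex set $\{(i,x):1\le i\le n,\ 0\le x\le 9\}$ in which $(i,x)\sim(i,y)$ whenever $\{x,y\}$ is an edge of $P$, and $(i,x)\sim(\sigma(i),y)$ whenever $(x,y)\in E(\vec P)$. -}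

module Defs where

open import Data.Nat using (ℕ; zero; suc; _≡ᵇ_; _+_)
open import Data.Bool using (Bool; true; false; _∨_; _∧_; if_then_else_)
open import Data.Fin using (Fin; toℕ)
open import Data.Product using (_×_; _,_; proj₁; proj₂; Σ)
open import Data.Bool.ListAction using (any)
open import Data.List using (List; []; _∷_; length; filter; cartesianProduct)
open import Data.List using (allFin)
open import Relation.Binary.PropositionalEquality using (_≡_)
open import Function.Bundles using (_↔_; Inverse)

petersenArcs : List (ℕ × ℕ)
petersenArcs =
  (0 , 1) ∷ (0 , 4) ∷ (0 , 5) ∷ (1 , 2) ∷ (1 , 6) ∷ (2 , 3) ∷ (2 , 7) ∷
  (3 , 4) ∷ (3 , 8) ∷ (4 , 9) ∷ (5 , 7) ∷ (5 , 8) ∷ (6 , 8) ∷ (6 , 9) ∷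
  (7 , 9) ∷ []

arc : Fin 10 → Fin 10 → Bool
arc x y = any (λ p → (proj₁ p ≡ᵇ toℕ x) ∧ (proj₂ p ≡ᵇ toℕ y)) petersenArcs

pEdge : Fin 10 → Fin 10 → Bool
pEdge x y = arc x y ∨ arc y x

-- Layers are indexed by Fin n (layer i here is layer i+1 of the paper).
-- σ on ℕ-values of Fin n: σ(i) = i + 1 mod n.
σ : (n : ℕ) → Fin n → ℕ
σ n i = if suc (toℕ i) ≡ᵇ n then 0 else suc (toℕ i)

Vertex : ℕ → Set
Vertex n = Fin n × Fin 10

crossArc : (n : ℕ) → Vertex n → Vertex n → Bool
crossArc n (i , x) (j , y) = (toℕ j ≡ᵇ σ n i) ∧ arc x y

adj : (n : ℕ) → Vertex n → Vertex n → Bool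
adj n (i , x) (j , y) =
  ((toℕ i ≡ᵇ toℕ j) ∧ pEdge x y)
  ∨ crossArc n (i , x) (j , y)
  ∨ crossArc n (j , y) (i , x)

record Automorphism (n : ℕ) : Set where
  field
    perm     : Vertex n ↔ Vertex n
    preserve : ∀ u v → adj n u v ≡ adj n (Inverse.to perm u) (Inverse.to perm v)

SameOrbit : (n : ℕ) → Vertex n → Vertex n → Set
SameOrbit n u v = Σ (Automorphism n) λ g → Inverse.to (Automorphism.perm g) u ≡ v

allVertices : (n : ℕ) → List (Vertex n)
allVertices n = cartesianProduct (allFin n) (allFin 10)

countColour : (n : ℕ) → (Vertex n → Bool) → Bool → ℕ
countColour n c b = length (filter (λ v → c v Data.Bool.≟ b) (allVertices n))

module Submission where

-- The rotation (i , x) ↦ (i + 1 , x) of the layers is an automorphism of G_n, and so is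
-- (i , x) ↦ (d x − 1 − i , τ x) whenever τ is an involution of the Petersen graph that maps each
-- arc of P⃗ either to a reversed arc, or to an arc in the same direction while the layer shift d
-- grows by one along it. Two such involutions, together with the rotation, move every outer
-- vertex (x < 5) to (0 , 0) and every inner vertex (x ≥ 5) to (0 , 5), so there are at most two
-- orbits, of 5n vertices each. They are distinct orbits because automorphisms preserve the number
-- of closed walks of length 5 at a vertex, and for every n ≥ 3 this number differs between an
-- outer and an inner vertex.

open import Defs
open import Data.Bool using (Bool; true; false; T; _∧_; if_then_else_)
open import Data.Bool.Properties using (T-≡; T-∨; T-∧; ⇔→≡; ¬-not)
import Data.Bool as Bool
open import Data.Empty using (⊥-elim)
open import Data.Fin using (Fin; zero; suc; toℕ; fromℕ; inject₁; opposite)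
open import Data.Fin.Patterns
open import Data.Fin.Properties
  using (toℕ-injective; toℕ-fromℕ; toℕ-inject₁; toℕ<n; opposite-involutive; all?; _≟_)
open import Data.Fin.Relation.Unary.Top using (view; ‵fromℕ; ‵inject₁; view-fromℕ; view-inject₁)
open import Data.List using (List; []; _∷_; map; filter; _++_; length; allFin; cartesianProduct)
open import Data.List.Properties
  using (filter-++; length-++; length-map; length-tabulate; map-∘; map-cong)
import Data.List.Properties as List
open import Data.List.Membership.Propositional using (_∈_)
open import Data.List.Membership.Propositional.Properties
  using (∈-map⁺; ∈-map⁻; ∈-filter⁺; ∈-filter⁻; ∈-++⁺ˡ; ∈-++⁺ʳ; ∈-++⁻; ∈-allFin)
open import Data.List.Membership.Propositional.Properties.WithK using (unique∧set⇒bag)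
open import Data.List.Relation.Binary.BagAndSetEquality using (∼bag⇒↭)
open import Data.List.Relation.Binary.Disjoint.Propositional using (Disjoint)
open import Data.List.Relation.Binary.Permutation.Propositional using (_↭_)
import Data.List.Relation.Binary.Permutation.Propositional.Properties as ↭
open import Data.List.Relation.Unary.Unique.Propositional using (Unique)
import Data.List.Relation.Unary.Unique.Propositional.Properties as Unique
open import Data.Nat using (ℕ; zero; suc; _+_; _*_; _≤_; _<ᵇ_; _≡ᵇ_; s≤s; z≤n)
open import Data.Nat.GeneralisedArithmetic using (fold)
open import Data.Nat.ListAction using (sum)
open import Data.Nat.ListAction.Properties using (sum-↭)
open import Data.Nat.Properties using (≡ᵇ⇒≡; ≡⇒≡ᵇ; <⇒≢; suc-injective; *-comm)
import Data.Nat.Properties as ℕ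
open import Data.Product using (Σ; _×_; _,_; proj₁; proj₂; map₁)
open import Data.Product.Properties using (≡-dec)
open import Data.Sum using (_⊎_; inj₁; inj₂; [_,_]′; swap)
open import Function using (id; _∘_; _⇔_; _↔_; Inverse; mk⇔; mk↔ₛ′; Equivalence)
open import Function.Construct.Composition using (_↔-∘_; _⇔-∘_)
open import Function.Construct.Identity using (↔-id)
open import Function.Construct.Symmetry using (↔-sym; ⇔-sym)
open import Function.Definitions using (Injective)
open import Relation.Binary.Definitions using (DecidableEquality)
open import Relation.Binary.PropositionalEquality
  using (_≡_; _≢_; refl; sym; trans; cong; cong₂; subst; subst₂; module ≡-Reasoning)
open import Relation.Nullary using (Dec; does; ¬_; ¬?; _×-dec_; _⊎-dec_; _→-dec_)
open import Relation.Nullary.Decidable using (T?; from-yes; map′; does-⇔)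
open import Relation.Unary using (Decidable)

open Equivalence using (to; from)
open ≡-Reasoning

fold-fusion : ∀ {A B : Set} {s : A → A} {t : B → B} (f : A → B) →
              (∀ a → f (s a) ≡ t (f a)) → ∀ z k → f (fold z s k) ≡ fold (f z) t k
fold-fusion f comm z zero    = refl
fold-fusion {s = s} {t} f comm z (suc k) =
  trans (comm (fold z s k)) (cong t (fold-fusion f comm z k))

fold-comm : ∀ {A : Set} (s : A → A) z k → s (fold z s k) ≡ fold (s z) s k
fold-comm s = fold-fusion s (λ _ → refl)

fold-inverse : ∀ {A : Set} {s t : A → A} → (∀ a → s (t a) ≡ a) →
               ∀ z k → fold (fold z t k) s k ≡ z
fold-inverse st z zero = refl
fold-inverse {s = s} {t} st z (suc k) = begin
  s (fold (t (fold z t k)) s k)  ≡⟨ fold-comm s _ k ⟩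
  fold (s (t (fold z t k))) s k  ≡⟨ cong (λ a → fold a s k) (st _) ⟩
  fold (fold z t k) s k          ≡⟨ fold-inverse st z k ⟩
  z                              ∎

filter-map : ∀ {A B : Set} {P : B → Set} (P? : Decidable P) (f : A → B) xs →
             filter P? (map f xs) ≡ map f (filter (P? ∘ f) xs)
filter-map P? f [] = refl
filter-map P? f (x ∷ xs) with does (P? (f x))
... | true  = cong (f x ∷_) (filter-map P? f xs)
... | false = filter-map P? f xs

length-filter-cartesianProduct :
  ∀ {A B : Set} {P : B → Set} (P? : Decidable P) (xs : List A) (ys : List B) →
  length (filter (P? ∘ proj₂) (cartesianProduct xs ys)) ≡ length xs * length (filter P? ys)
length-filter-cartesianProduct P? [] ys = refl
length-filter-cartesianProduct P? (x ∷ xs) ys = begin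
  length (filter (P? ∘ proj₂) (map (x ,_) ys ++ cartesianProduct xs ys))
    ≡⟨ cong length (filter-++ (P? ∘ proj₂) (map (x ,_) ys) _) ⟩
  length (filter (P? ∘ proj₂) (map (x ,_) ys) ++ filter (P? ∘ proj₂) (cartesianProduct xs ys))
    ≡⟨ length-++ (filter (P? ∘ proj₂) (map (x ,_) ys)) ⟩
  length (filter (P? ∘ proj₂) (map (x ,_) ys)) + length (filter (P? ∘ proj₂) (cartesianProduct xs ys))
    ≡⟨ cong₂ _+_ (trans (cong length (filter-map (P? ∘ proj₂) (x ,_) ys)) (length-map (x ,_) (filter P? ys)))
                 (length-filter-cartesianProduct P? xs ys) ⟩
  length (filter P? ys) + length xs * length (filter P? ys)
    ∎

Disjoint-++ʳ : ∀ {A : Set} {xs ys zs : List A} → Disjoint xs ys → Disjoint xs zs → Disjoint xs (ys ++ zs)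
Disjoint-++ʳ {ys = ys} xs#ys xs#zs (v∈xs , v∈ys++zs) =
  [ xs#ys ∘ (v∈xs ,_) , xs#zs ∘ (v∈xs ,_) ]′ (∈-++⁻ ys v∈ys++zs)

map-pair-disjoint : ∀ {A B : Set} {a b : A} {xs ys : List B} → a ≢ b →
                    Disjoint (map (a ,_) xs) (map (b ,_) ys)
map-pair-disjoint a≢b (p , q) with ∈-map⁻ _ p | ∈-map⁻ _ q
... | _ , _ , refl | _ , _ , e = a≢b (cong proj₁ e)

map-pair-unique : ∀ {A B : Set} (a : A) {xs : List B} → Unique xs → Unique (map (a ,_) xs)
map-pair-unique a = Unique.map⁺ (cong proj₂)

∈-filter-allFin : ∀ {n} (p : Fin n → Bool) {y} → y ∈ filter (λ y → T? (p y)) (allFin n) ⇔ T (p y)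
∈-filter-allFin {n} p = mk⇔ (proj₂ ∘ ∈-filter⁻ (T? ∘ p) {xs = allFin n}) (∈-filter⁺ (T? ∘ p) (∈-allFin _))

T-injective : ∀ {a b} → T a ⇔ T b → a ≡ b
T-injective h = ⇔→≡ (T-≡ ⇔-∘ (h ⇔-∘ ⇔-sym T-≡))

module Walks {V : Set} (_≟ᵥ_ : DecidableEquality V) (N : V → List V) where

  walks : ℕ → V → V → ℕ
  walks zero    u w = if does (u ≟ᵥ w) then 1 else 0
  walks (suc k) u w = sum (map (λ z → walks k z w) (N u))

  walks-invariant : (g : V → V) → Injective _≡_ _≡_ g → (∀ u → map g (N u) ↭ N (g u)) →
                    ∀ k u w → walks k (g u) (g w) ≡ walks k u w
  walks-invariant g g-inj g-perm zero u w =
    cong (λ b → if b then 1 else 0) (does-⇔ (mk⇔ g-inj (cong g)) (g u ≟ᵥ g w) (u ≟ᵥ w))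
  walks-invariant g g-inj g-perm (suc k) u w = begin
    sum (map (λ z → walks k z (g w)) (N (g u)))
      ≡⟨ sum-↭ (↭.map⁺ (λ z → walks k z (g w)) (g-perm u)) ⟨
    sum (map (λ z → walks k z (g w)) (map g (N u)))
      ≡⟨ cong sum (map-∘ (N u)) ⟨
    sum (map (λ z → walks k (g z) (g w)) (N u))
      ≡⟨ cong sum (map-cong (λ z → walks-invariant g g-inj g-perm k z w) (N u)) ⟩
    sum (map (λ z → walks k z w) (N u))
      ∎

  module _ (R : V → V → Set) (∈-N : ∀ {u v} → v ∈ N u ⇔ R u v) (N-unique : ∀ u → Unique (N u)) where

    walks-isomorphism-invariant : (g : V ↔ V) → (∀ u v → R u v ⇔ R (Inverse.to g u) (Inverse.to g v)) →
                                  ∀ k u w → walks k (Inverse.to g u) (Inverse.to g w) ≡ walks k u w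
    walks-isomorphism-invariant g g-pres = walks-invariant f f-injective permutes
      where
      open Inverse g using (strictlyInverseˡ; strictlyInverseʳ) renaming (to to f; from to f⁻¹)
      f-injective : Injective _≡_ _≡_ f
      f-injective {u} {v} e = trans (sym (strictlyInverseʳ u)) (trans (cong f⁻¹ e) (strictlyInverseʳ v))
      permutes : ∀ u → map f (N u) ↭ N (f u)
      permutes u = ∼bag⇒↭ (unique∧set⇒bag (Unique.map⁺ f-injective (N-unique u)) (N-unique (f u))
                                         (mk⇔ forth back))
        where
        forth : ∀ {z} → z ∈ map f (N u) → z ∈ N (f u)
        forth z∈ with ∈-map⁻ f z∈
        ... | z′ , z′∈ , refl = from ∈-N (to (g-pres u z′) (to ∈-N z′∈))
        back : ∀ {z} → z ∈ N (f u) → z ∈ map f (N u)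
        back {z} z∈ = subst (_∈ map f (N u)) (strictlyInverseˡ z)
          (∈-map⁺ f (from ∈-N (from (g-pres u (f⁻¹ z))
            (subst (R (f u)) (sym (strictlyInverseˡ z)) (to ∈-N z∈)))))

-- The cycle of layers

next : ∀ {n} → Fin n → Fin n
next {suc m} i with view i
... | ‵fromℕ     = zero
... | ‵inject₁ j = suc j

prev : ∀ {n} → Fin n → Fin n
prev {suc m} zero = fromℕ m
prev (suc i)      = inject₁ i

prev-next : ∀ {n} (i : Fin n) → prev (next i) ≡ i
prev-next {suc m} i with view i
... | ‵fromℕ     = refl
... | ‵inject₁ j = refl

next-prev : ∀ {n} (i : Fin n) → next (prev i) ≡ i
next-prev {suc m} zero rewrite view-fromℕ m = refl
next-prev (suc i) rewrite view-inject₁ i    = refl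

next-prev-comm : ∀ {n} (i : Fin n) → next (prev i) ≡ prev (next i)
next-prev-comm i = trans (next-prev i) (sym (prev-next i))

toℕ-next : ∀ {n} (i : Fin n) → toℕ (next i) ≡ σ n i
toℕ-next {suc m} i with view i
... | ‵fromℕ rewrite toℕ-fromℕ m | to T-≡ (≡⇒≡ᵇ m m refl) = refl
... | ‵inject₁ j rewrite toℕ-inject₁ j | ¬-not (<⇒≢ (toℕ<n j) ∘ ≡ᵇ⇒≡ _ _ ∘ from T-≡) = refl

opposite-fromℕ : ∀ m → opposite (fromℕ m) ≡ zero
opposite-fromℕ zero    = refl
opposite-fromℕ (suc m) = cong inject₁ (opposite-fromℕ m)

opposite-inject₁ : ∀ {m} (j : Fin m) → opposite (inject₁ j) ≡ suc (opposite j)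
opposite-inject₁ {suc m} zero = refl
opposite-inject₁ (suc j)      = cong inject₁ (opposite-inject₁ j)

opposite-next : ∀ {n} (i : Fin n) → opposite (next i) ≡ prev (opposite i)
opposite-next {suc m} i with view i
... | ‵fromℕ rewrite opposite-fromℕ m       = refl
... | ‵inject₁ j rewrite opposite-inject₁ j = refl

next-fold-opposite-next : ∀ {n} (i : Fin n) k →
                          next (fold (opposite (next i)) next k) ≡ fold (opposite i) next k
next-fold-opposite-next i k = begin
  next (fold (opposite (next i)) next k)  ≡⟨ fold-comm next _ k ⟩
  fold (next (opposite (next i))) next k  ≡⟨ cong (λ j → fold (next j) next k) (opposite-next i) ⟩
  fold (next (prev (opposite i))) next k  ≡⟨ cong (λ j → fold j next k) (next-prev (opposite i)) ⟩
  fold (opposite i) next k                ∎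

fold-prev-toℕ : ∀ {m} (i : Fin (suc m)) → fold i prev (toℕ i) ≡ zero
fold-prev-toℕ i = go i refl
  where
  go : ∀ {m k} (i : Fin (suc m)) → toℕ i ≡ k → fold i prev k ≡ zero
  go {k = zero}  zero    _ = refl
  go {k = suc k} (suc i) e =
    trans (fold-comm prev (suc i) k) (go (inject₁ i) (trans (toℕ-inject₁ i) (suc-injective e)))

fixed-point⇒fixes-zero : ∀ {m} (f : Fin (suc m) → Fin (suc m)) → (∀ i → f (prev i) ≡ prev (f i)) →
                         ∀ {i} → f i ≡ i → f zero ≡ zero
fixed-point⇒fixes-zero f comm {i} fi≡i = begin
  f zero                   ≡⟨ cong f (fold-prev-toℕ i) ⟨
  f (fold i prev (toℕ i))  ≡⟨ fold-fusion f comm i (toℕ i) ⟩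
  fold (f i) prev (toℕ i)  ≡⟨ cong (λ j → fold j prev (toℕ i)) fi≡i ⟩
  fold i prev (toℕ i)      ≡⟨ fold-prev-toℕ i ⟩
  zero                     ∎

-- In both proofs the map fixes 0 by fixed-point⇒fixes-zero, while it sends 0 to 1, resp. 2, by evaluation.
next≢id : ∀ {m} (i : Fin (2 + m)) → next i ≢ i
next≢id i e with fixed-point⇒fixes-zero next next-prev-comm e
... | ()

next²≢id : ∀ {m} (i : Fin (3 + m)) → next (next i) ≢ i
next²≢id i e
  with fixed-point⇒fixes-zero (next ∘ next) (λ j → trans (cong next (next-prev j)) (sym (prev-next (next j)))) e
... | ()

-- The oriented Petersen graph

arcsFrom arcsTo : Fin 10 → List (Fin 10)
arcsFrom x = filter (λ y → T? (arc x y)) (allFin 10)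
arcsTo   x = filter (λ y → T? (arc y x)) (allFin 10)

-- arcsFrom and arcsTo spelled out, so that the closed-walk counts below evaluate quickly.
outs : Fin 10 → List (Fin 10)
outs 0F = 1F ∷ 4F ∷ 5F ∷ []
outs 1F = 2F ∷ 6F ∷ []
outs 2F = 3F ∷ 7F ∷ []
outs 3F = 4F ∷ 8F ∷ []
outs 4F = 9F ∷ []
outs 5F = 7F ∷ 8F ∷ []
outs 6F = 8F ∷ 9F ∷ []
outs 7F = 9F ∷ []
outs 8F = []
outs 9F = []

ins : Fin 10 → List (Fin 10)
ins 0F = []
ins 1F = 0F ∷ []
ins 2F = 1F ∷ []
ins 3F = 2F ∷ []
ins 4F = 0F ∷ 3F ∷ []
ins 5F = 0F ∷ []
ins 6F = 1F ∷ []
ins 7F = 2F ∷ 5F ∷ []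
ins 8F = 3F ∷ 5F ∷ 6F ∷ []
ins 9F = 4F ∷ 6F ∷ 7F ∷ []

outs≡arcsFrom : ∀ x → outs x ≡ arcsFrom x
outs≡arcsFrom = from-yes (all? λ x → List.≡-dec _≟_ (outs x) (arcsFrom x))

ins≡arcsTo : ∀ x → ins x ≡ arcsTo x
ins≡arcsTo = from-yes (all? λ x → List.≡-dec _≟_ (ins x) (arcsTo x))

arc-asym : ∀ x y → ¬ (T (arc x y) × T (arc y x))
arc-asym = from-yes (all? λ x → all? λ y → ¬? (T? (arc x y) ×-dec T? (arc y x)))

∈-outs : ∀ x y → y ∈ outs x ⇔ T (arc x y)
∈-outs x y rewrite outs≡arcsFrom x = ∈-filter-allFin (arc x)

∈-ins : ∀ x y → y ∈ ins x ⇔ T (arc y x)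
∈-ins x y rewrite ins≡arcsTo x = ∈-filter-allFin (λ y → arc y x)

outs-unique : ∀ x → Unique (outs x)
outs-unique x rewrite outs≡arcsFrom x = Unique.filter⁺ (λ y → T? (arc x y)) (Unique.allFin⁺ 10)

ins-unique : ∀ x → Unique (ins x)
ins-unique x rewrite ins≡arcsTo x = Unique.filter⁺ (λ y → T? (arc y x)) (Unique.allFin⁺ 10)

-- Adjacency in G_n

data Arc {n} : Vertex n → Vertex n → Set where
  flat : ∀ {i x y} → T (arc x y) → Arc (i , x) (i , y)
  rise : ∀ {i x y} → T (arc x y) → Arc (i , x) (next i , y)

Adj : ∀ {n} → Vertex n → Vertex n → Set
Adj u v = Arc u v ⊎ Arc v u

Adj-map : ∀ {n} {f : Vertex n → Vertex n} → (∀ {u v} → Arc u v → Adj (f u) (f v)) →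
          ∀ {u v} → Adj u v → Adj (f u) (f v)
Adj-map f-arc = [ f-arc , swap ∘ f-arc ]′

same-layer : ∀ {n} (i j : Fin n) → T (toℕ i ≡ᵇ toℕ j) ⇔ i ≡ j
same-layer i j = mk⇔ (toℕ-injective ∘ ≡ᵇ⇒≡ (toℕ i) (toℕ j)) (≡⇒≡ᵇ (toℕ i) (toℕ j) ∘ cong toℕ)

next-layer : ∀ {n} (i j : Fin n) → T (toℕ j ≡ᵇ σ n i) ⇔ j ≡ next i
next-layer i j rewrite sym (toℕ-next i) = same-layer j (next i)

adj⇒Adj : ∀ {n} {u v : Vertex n} → T (adj n u v) → Adj u v
adj⇒Adj {n} {i , x} {j , y} t = [ inLayer , [ forward , backward ]′ ∘ to T-∨ ]′ (to T-∨ t)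
  where
  inLayer : T ((toℕ i ≡ᵇ toℕ j) ∧ pEdge x y) → Adj (i , x) (j , y)
  inLayer t with to T-∧ t
  ... | e , p = subst (λ k → Adj (i , x) (k , y)) (to (same-layer i j) e)
                      ([ inj₁ ∘ flat , inj₂ ∘ flat ]′ (to T-∨ p))
  forward : T (crossArc n (i , x) (j , y)) → Adj (i , x) (j , y)
  forward t with to T-∧ t
  ... | e , a = subst (λ k → Adj (i , x) (k , y)) (sym (to (next-layer i j) e)) (inj₁ (rise a))
  backward : T (crossArc n (j , y) (i , x)) → Adj (i , x) (j , y)
  backward t with to T-∧ t
  ... | e , a = subst (λ k → Adj (k , x) (j , y)) (sym (to (next-layer j i) e)) (inj₂ (rise a))

Adj⇒adj : ∀ {n} {u v : Vertex n} → Adj u v → T (adj n u v)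
Adj⇒adj (inj₁ (flat {i} {x} {y} a)) =
  from T-∨ (inj₁ (from T-∧ (from (same-layer i i) refl , from T-∨ (inj₁ a))))
Adj⇒adj (inj₂ (flat {i} {y} {x} a)) =
  from T-∨ (inj₁ (from T-∧ (from (same-layer i i) refl , from (T-∨ {arc x y}) (inj₂ a))))
Adj⇒adj {n} (inj₁ (rise {i} {x} {y} a)) =
  from (T-∨ {(toℕ i ≡ᵇ toℕ (next i)) ∧ pEdge x y})
       (inj₂ (from T-∨ (inj₁ (from T-∧ (from (next-layer i (next i)) refl , a)))))
Adj⇒adj {n} (inj₂ (rise {j} {y} {x} a)) =
  from (T-∨ {(toℕ (next j) ≡ᵇ toℕ j) ∧ pEdge x y})
       (inj₂ (from (T-∨ {crossArc n (next j , x) (j , y)})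
                   (inj₂ (from T-∧ (from (next-layer j (next j)) refl , a)))))

adj⇔Adj : ∀ {n} {u v : Vertex n} → T (adj n u v) ⇔ Adj u v
adj⇔Adj = mk⇔ adj⇒Adj Adj⇒adj

-- Automorphisms

automorphism : ∀ {n} (φ : Vertex n ↔ Vertex n) →
               (∀ {u v} → Arc u v → Adj (Inverse.to φ u) (Inverse.to φ v)) →
               (∀ {u v} → Arc u v → Adj (Inverse.from φ u) (Inverse.from φ v)) →
               Automorphism n
automorphism {n} φ to-arc from-arc = record
  { perm     = φ
  ; preserve = λ u v → T-injective (mk⇔ (Adj⇒adj ∘ Adj-map to-arc ∘ adj⇒Adj) (reflects u v))
  }
  where
  open Inverse φ using (strictlyInverseʳ)
  reflects : ∀ u v → T (adj n (Inverse.to φ u) (Inverse.to φ v)) → T (adj n u v)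
  reflects u v = subst₂ (λ u′ v′ → T (adj n u′ v′)) (strictlyInverseʳ u) (strictlyInverseʳ v)
               ∘ Adj⇒adj ∘ Adj-map from-arc ∘ adj⇒Adj

module _ {n : ℕ} where

  orbit-refl : ∀ {u} → SameOrbit n u u
  orbit-refl = record { perm = ↔-id _ ; preserve = λ _ _ → refl } , refl

  orbit-sym : ∀ {u v} → SameOrbit n u v → SameOrbit n v u
  orbit-sym {u} (g , refl) = g⁻¹ , strictlyInverseʳ u
    where
    open Automorphism g
    open Inverse perm using (strictlyInverseˡ; strictlyInverseʳ)
    g⁻¹ : Automorphism n
    g⁻¹ = record
      { perm     = ↔-sym perm
      ; preserve = λ u v → sym (trans (preserve _ _) (cong₂ (adj n) (strictlyInverseˡ u) (strictlyInverseˡ v)))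
      }

  orbit-trans : ∀ {u v w} → SameOrbit n u v → SameOrbit n v w → SameOrbit n u w
  orbit-trans (g , refl) (h , refl) = record
    { perm     = Automorphism.perm h ↔-∘ Automorphism.perm g
    ; preserve = λ u v → trans (Automorphism.preserve g u v) (Automorphism.preserve h _ _)
    } , refl

rotation : ∀ n → Automorphism n
rotation n = automorphism (mk↔ₛ′ (map₁ next) (map₁ prev) (λ (i , x) → cong (_, x) (next-prev i))
                                                        (λ (i , x) → cong (_, x) (prev-next i)))
                          up down
  where
  up : ∀ {u v} → Arc u v → Adj (map₁ next u) (map₁ next v)
  up (flat a) = inj₁ (flat a)
  up (rise a) = inj₁ (rise a)
  down : ∀ {u v} → Arc u v → Adj (map₁ prev u) (map₁ prev v)
  down (flat a) = inj₁ (flat a)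
  down (rise {i} {x} {y} a) = inj₁ (subst (λ j → Arc (prev i , x) (j , y)) (next-prev-comm i) (rise a))

-- Reflecting the layers reverses every arc between consecutive layers, so an arc x → y of P⃗ must
-- go to the reversed arc τ y → τ x with equal shifts, or to τ x → τ y with the shift of y one larger
-- (its copies between consecutive layers then land inside a layer).
ArcImage : (Fin 10 → Fin 10) → (Fin 10 → ℕ) → Fin 10 → Fin 10 → Set
ArcImage τ d x y = (d y ≡ d x × T (arc (τ y) (τ x))) ⊎ (d y ≡ suc (d x) × T (arc (τ x) (τ y)))

record IsReflection (τ : Fin 10 → Fin 10) (d : Fin 10 → ℕ) : Set where
  field
    involutive  : ∀ x → τ (τ x) ≡ x
    d-invariant : ∀ x → d (τ x) ≡ d x
    arc-image   : ∀ x y → T (arc x y) → ArcImage τ d x y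

isReflection? : ∀ τ d → Dec (IsReflection τ d)
isReflection? τ d =
  map′ (λ (i , s , a) → record { involutive = i ; d-invariant = s ; arc-image = a })
       (λ r → IsReflection.involutive r , IsReflection.d-invariant r , IsReflection.arc-image r)
       (all? (λ x → τ (τ x) ≟ x) ×-dec all? (λ x → d (τ x) ℕ.≟ d x) ×-dec all? λ x → all? λ y →
          T? (arc x y) →-dec ((d y ℕ.≟ d x ×-dec T? (arc (τ y) (τ x)))
                               ⊎-dec (d y ℕ.≟ suc (d x) ×-dec T? (arc (τ x) (τ y)))))

module Reflection {τ d} (isReflection : IsReflection τ d) (n : ℕ) where
  open IsReflection isReflection

  reflect : Vertex n → Vertex n
  reflect (i , x) = fold (opposite i) next (d x) , τ x

  reflect-involutive : ∀ v → reflect (reflect v) ≡ v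
  reflect-involutive (i , x) rewrite d-invariant x | involutive x = cong (_, x) (begin
    fold (opposite (fold (opposite i) next k)) next k
      ≡⟨ cong (λ j → fold j next k) (fold-fusion opposite opposite-next (opposite i) k) ⟩
    fold (fold (opposite (opposite i)) prev k) next k
      ≡⟨ cong (λ j → fold (fold j prev k) next k) (opposite-involutive i) ⟩
    fold (fold i prev k) next k
      ≡⟨ fold-inverse next-prev i k ⟩
    i ∎)
    where k = d x

  reflect-arc : ∀ {u v} → Arc u v → Adj (reflect u) (reflect v)
  reflect-arc (flat {i} {x} {y} a) with arc-image x y a
  ... | inj₁ (e , a′) rewrite e = inj₂ (flat a′)
  ... | inj₂ (e , a′) rewrite e = inj₁ (rise a′)
  reflect-arc (rise {i} {x} {y} a) with arc-image x y a
  ... | inj₁ (e , a′) rewrite e =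
    inj₂ (subst (λ j → Arc (fold (opposite (next i)) next (d x) , τ y) (j , τ x))
                (next-fold-opposite-next i (d x)) (rise a′))
  ... | inj₂ (e , a′) rewrite e =
    subst (λ j → Adj (j , τ x) (next (fold (opposite (next i)) next (d x)) , τ y))
          (next-fold-opposite-next i (d x)) (inj₁ (flat a′))

  reflection : Automorphism n
  reflection = automorphism (mk↔ₛ′ reflect reflect reflect-involutive reflect-involutive)
                            reflect-arc reflect-arc

τ₁ τ₂ : Fin 10 → Fin 10
τ₁ 0F = 1F
τ₁ 1F = 0F
τ₁ 2F = 4F
τ₁ 3F = 3F
τ₁ 4F = 2F
τ₁ 5F = 6F
τ₁ 6F = 5F
τ₁ 7F = 9F
τ₁ 8F = 8F
τ₁ 9F = 7F
τ₂ 0F = 2F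
τ₂ 1F = 1F
τ₂ 2F = 0F
τ₂ 3F = 4F
τ₂ 4F = 3F
τ₂ 5F = 7F
τ₂ 6F = 6F
τ₂ 7F = 5F
τ₂ 8F = 9F
τ₂ 9F = 8F

d₁ d₂ : Fin 10 → ℕ
d₁ 0F = 0
d₁ 1F = 0
d₁ 7F = 2
d₁ 8F = 2
d₁ 9F = 2
d₁ _  = 1
d₂ 0F = 0
d₂ 1F = 0
d₂ 2F = 0
d₂ 8F = 2
d₂ 9F = 2
d₂ _  = 1

module Reflection₁ = Reflection (from-yes (isReflection? τ₁ d₁))
module Reflection₂ = Reflection (from-yes (isReflection? τ₂ d₂))

-- The two orbits

outer : Fin 10 → Bool
outer x = toℕ x <ᵇ 5

representative : Bool → Fin 10
representative true  = 0F
representative false = 5F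

outer-representative : ∀ b → outer (representative b) ≡ b
outer-representative true  = refl
outer-representative false = refl

module _ {m : ℕ} where
  private
    n = suc m
    _⟫_ = orbit-trans {n}
    infixr 5 _⟫_

  to-layer-zero : ∀ i x → SameOrbit n (i , x) (zero , x)
  to-layer-zero i x = subst (λ j → SameOrbit n (i , x) (j , x)) (fold-prev-toℕ i) (rotate-back (toℕ i))
    where
    rotate-back : ∀ k → SameOrbit n (i , x) (fold i prev k , x)
    rotate-back zero    = orbit-refl
    rotate-back (suc k) = rotate-back k ⟫ orbit-sym (rotation n , cong (_, x) (next-prev _))

  across-layers : ∀ i j x → SameOrbit n (i , x) (j , x)
  across-layers i j x = to-layer-zero i x ⟫ orbit-sym (to-layer-zero j x)

  τ₁-orbit : ∀ i j x → SameOrbit n (i , x) (j , τ₁ x)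
  τ₁-orbit i j x = (Reflection₁.reflection n , refl) ⟫ across-layers _ j (τ₁ x)

  τ₂-orbit : ∀ i j x → SameOrbit n (i , x) (j , τ₂ x)
  τ₂-orbit i j x = (Reflection₂.reflection n , refl) ⟫ across-layers _ j (τ₂ x)

  to-representative : ∀ i x → SameOrbit n (i , x) (zero , representative (outer x))
  to-representative i 0F = to-layer-zero i 0F
  to-representative i 1F = τ₁-orbit i zero 1F
  to-representative i 2F = τ₂-orbit i zero 2F
  to-representative i 3F = τ₂-orbit i zero 3F ⟫ τ₁-orbit zero zero 4F ⟫ τ₂-orbit zero zero 2F
  to-representative i 4F = τ₁-orbit i zero 4F ⟫ τ₂-orbit zero zero 2F
  to-representative i 5F = to-layer-zero i 5F
  to-representative i 6F = τ₁-orbit i zero 6F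
  to-representative i 7F = τ₂-orbit i zero 7F
  to-representative i 8F = τ₂-orbit i zero 8F ⟫ τ₁-orbit zero zero 9F ⟫ τ₂-orbit zero zero 7F
  to-representative i 9F = τ₁-orbit i zero 9F ⟫ τ₂-orbit zero zero 7F

  same-side⇒same-orbit : ∀ {i j x y} → outer x ≡ outer y → SameOrbit n (i , x) (j , y)
  same-side⇒same-orbit {i} {j} {x} {y} e =
    to-representative i x ⟫ subst (λ b → SameOrbit n (zero , representative b) (j , y)) (sym e)
                                  (orbit-sym (to-representative j y))

-- Closed walks of length 5

neighbours : ∀ {n} → Vertex n → List (Vertex n)
neighbours (i , x) = map (i ,_) (outs x ++ ins x) ++ map (next i ,_) (outs x) ++ map (prev i ,_) (ins x)

∈-neighbours⁻ : ∀ {n} {u v : Vertex n} → v ∈ neighbours u → Adj u v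
∈-neighbours⁻ {u = i , x} v∈ with ∈-++⁻ (map (i ,_) (outs x ++ ins x)) v∈
... | inj₁ v∈₁ with ∈-map⁻ (i ,_) v∈₁
...   | y , y∈ , refl = [ inj₁ ∘ flat ∘ to (∈-outs x y) , inj₂ ∘ flat ∘ to (∈-ins x y) ]′ (∈-++⁻ (outs x) y∈)
∈-neighbours⁻ {u = i , x} v∈ | inj₂ v∈₂₃ with ∈-++⁻ (map (next i ,_) (outs x)) v∈₂₃
... | inj₁ v∈₂ with ∈-map⁻ (next i ,_) v∈₂
...   | y , y∈ , refl = inj₁ (rise (to (∈-outs x y) y∈))
∈-neighbours⁻ {u = i , x} v∈ | inj₂ v∈₂₃ | inj₂ v∈₃ with ∈-map⁻ (prev i ,_) v∈₃
...   | y , y∈ , refl = inj₂ (subst (λ k → Arc (prev i , y) (k , x)) (next-prev i) (rise (to (∈-ins x y) y∈)))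

∈-neighbours⁺ : ∀ {n} {u v : Vertex n} → Adj u v → v ∈ neighbours u
∈-neighbours⁺ (inj₁ (flat {i} {x} {y} a)) =
  ∈-++⁺ˡ (∈-map⁺ (i ,_) (∈-++⁺ˡ {ys = ins x} (from (∈-outs x y) a)))
∈-neighbours⁺ (inj₂ (flat {i} {y} {x} a)) =
  ∈-++⁺ˡ (∈-map⁺ (i ,_) (∈-++⁺ʳ (outs x) (from (∈-ins x y) a)))
∈-neighbours⁺ (inj₁ (rise {i} {x} {y} a)) =
  ∈-++⁺ʳ (map (i ,_) (outs x ++ ins x)) (∈-++⁺ˡ (∈-map⁺ (next i ,_) (from (∈-outs x y) a)))
∈-neighbours⁺ (inj₂ (rise {j} {y} {x} a)) =
  ∈-++⁺ʳ (map (next j ,_) (outs x ++ ins x)) (∈-++⁺ʳ (map (next (next j) ,_) (outs x))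
    (subst (λ k → (k , y) ∈ map (prev (next j) ,_) (ins x)) (prev-next j)
           (∈-map⁺ (prev (next j) ,_) (from (∈-ins x y) a))))

∈-neighbours : ∀ {n} {u v : Vertex n} → v ∈ neighbours u ⇔ Adj u v
∈-neighbours = mk⇔ ∈-neighbours⁻ ∈-neighbours⁺

neighbours-unique : ∀ {m} (u : Vertex (3 + m)) → Unique (neighbours u)
neighbours-unique (i , x) =
  Unique.++⁺ (map-pair-unique i inLayer-unique)
             (Unique.++⁺ (map-pair-unique (next i) (outs-unique x)) (map-pair-unique (prev i) (ins-unique x))
                         (map-pair-disjoint next≢prev))
             (Disjoint-++ʳ {ys = map (next i ,_) (outs x)}
                           (map-pair-disjoint (next≢id i ∘ sym))
                           (map-pair-disjoint (λ e → next≢id i (trans (cong next e) (next-prev i)))))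
  where
  inLayer-unique : Unique (outs x ++ ins x)
  inLayer-unique = Unique.++⁺ (outs-unique x) (ins-unique x)
                              (λ {y} (p , q) → arc-asym x y (to (∈-outs x y) p , to (∈-ins x y) q))
  next≢prev : next i ≢ prev i
  next≢prev e = next²≢id i (trans (cong next e) (next-prev i))

_≟ᵥ_ : ∀ {n} → DecidableEquality (Vertex n)
_≟ᵥ_ = ≡-dec _≟_ _≟_

module _ {n : ℕ} where
  open Walks (_≟ᵥ_ {n}) neighbours public

closedWalks₅ : ∀ {n} → Vertex n → ℕ
closedWalks₅ v = walks 5 v v

-- The vertices are explicit: unifying against closedWalks₅ u would unfold the whole walk count.
closedWalks₅-invariant : ∀ {m} (u v : Vertex (3 + m)) → SameOrbit (3 + m) u v →
                         closedWalks₅ u ≡ closedWalks₅ v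
closedWalks₅-invariant u _ (g , refl) =
  sym (walks-isomorphism-invariant Adj ∈-neighbours neighbours-unique perm preserves 5 u u)
  where
  open Automorphism g
  preserves : ∀ u v → Adj u v ⇔ Adj (Inverse.to perm u) (Inverse.to perm v)
  preserves u v = adj⇔Adj ⇔-∘ (mk⇔ (subst T (preserve u v)) (subst T (sym (preserve u v))) ⇔-∘ ⇔-sym adj⇔Adj)

-- The counts are 130 and 132 for n = 3, 112 and 120 for n = 4, 110 and 120 for n ≥ 5. For n ≥ 11 they
-- are evaluated in layer 5, where closed walks of length 5 do not reach the wrap-around of the layers.
closedWalks₅-separates : ∀ m → Σ (Fin (3 + m)) λ i →
                         closedWalks₅ (i , representative true) ≢ closedWalks₅ (i , representative false)
closedWalks₅-separates 0 = 0F , λ ()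
closedWalks₅-separates 1 = 0F , λ ()
closedWalks₅-separates 2 = 0F , λ ()
closedWalks₅-separates 3 = 0F , λ ()
closedWalks₅-separates 4 = 0F , λ ()
closedWalks₅-separates 5 = 0F , λ ()
closedWalks₅-separates 6 = 0F , λ ()
closedWalks₅-separates 7 = 0F , λ ()
closedWalks₅-separates (suc (suc (suc (suc (suc (suc (suc (suc m)))))))) = 5F , λ ()

same-orbit⇒same-side : ∀ {m i j x y} → SameOrbit (3 + m) (i , x) (j , y) → outer x ≡ outer y
same-orbit⇒same-side {m} {i} {j} {x} {y} o = separated (outer x) (outer y) (begin
  closedWalks₅ repˣ
    ≡⟨ closedWalks₅-invariant repˣ (i , x) (same-side⇒same-orbit (outer-representative _)) ⟩
  closedWalks₅ (i , x)
    ≡⟨ closedWalks₅-invariant (i , x) (j , y) o ⟩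
  closedWalks₅ (j , y)
    ≡⟨ closedWalks₅-invariant (j , y) repʸ (same-side⇒same-orbit (sym (outer-representative _))) ⟩
  closedWalks₅ repʸ
    ∎)
  where
  l = proj₁ (closedWalks₅-separates m)
  repˣ = l , representative (outer x)
  repʸ = l , representative (outer y)
  separated : ∀ a b → closedWalks₅ (l , representative a) ≡ closedWalks₅ (l , representative b) → a ≡ b
  separated true  true  _ = refl
  separated false false _ = refl
  separated true  false e = ⊥-elim (proj₂ (closedWalks₅-separates m) e)
  separated false true  e = ⊥-elim (proj₂ (closedWalks₅-separates m) (sym e))

count-side : ∀ n b → countColour n (outer ∘ proj₂) b ≡ 5 * n
count-side n b = begin
  countColour n (outer ∘ proj₂) b
    ≡⟨ length-filter-cartesianProduct (λ x → outer x Bool.≟ b) (allFin n) (allFin 10) ⟩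
  length (allFin n) * length (filter (λ x → outer x Bool.≟ b) (allFin 10))
    ≡⟨ cong₂ _*_ (length-tabulate {n = n} id) (five-per-side b) ⟩
  n * 5
    ≡⟨ *-comm n 5 ⟩
  5 * n
    ∎
  where
  five-per-side : ∀ b → length (filter (λ x → outer x Bool.≟ b) (allFin 10)) ≡ 5
  five-per-side true  = refl
  five-per-side false = refl

corollary4p2 : (n : ℕ) → 3 ≤ n →
    Σ (Vertex n → Bool) λ c →
      (∀ u v → SameOrbit n u v ⇔ (c u ≡ c v))
      × (countColour n c true ≡ 5 * n)
      × (countColour n c false ≡ 5 * n)
corollary4p2 n@(suc (suc (suc m))) (s≤s (s≤s (s≤s z≤n))) =
  outer ∘ proj₂ ,
  (λ u v → mk⇔ same-orbit⇒same-side same-side⇒same-orbit) ,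
  count-side n true ,
  count-side n false
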